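{- Let $V$ be a finite set and $F\subseteq V\times V$. If $F=\operatorname{Arcs}C$ for some path cover $C$ of $V$, then there are exactly $|C|!$ many permutations $\sigma\in\mathfrak{S}_V$ satisfying $F\subseteq\mathbf{A}_\sigma$.
   Context: A path of $V$ is a nonempty tuple of distinct elements of $V$; a path cover of $V$ is a set of paths of $V$ such that each $v\in V$ is an entry of exactly one of them. For a tuple $v=(v_1,\dots,v_k)$, $\operatorname{Arcs}v=\{(v_i,v_{i+1}):i\in[k-1]\}$; $\operatorname{Arcs}C=\bigcup_{v\in C}\operatorname{Arcs}v$. For a permutation $\sigma$ of $V$, $\mathbf{A}_\sigma=\{(v,\sigma(v)):v\in V\}$. -}

module Defs where

open import Data.Nat using (ℕ; _!)
open import Data.Fin using (Fin)
open import Data.Fin.Permutation using (Permutation′; _⟨$⟩ʳ_; _≈_)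
open import Data.List using (List; []; _∷_; length; lookup; concatMap)
open import Data.List.Relation.Unary.All using (All)
open import Data.List.Relation.Unary.Unique.Propositional using (Unique)
open import Data.List.Membership.Propositional using (_∈_)
open import Data.Product using (Σ; _×_; _,_)
open import Relation.Binary.PropositionalEquality using (_≡_; _≢_)

IsPath : ∀ {n} → List (Fin n) → Set
IsPath p = (p ≢ []) × Unique p

Arcs : ∀ {A : Set} → List A → List (A × A)
Arcs []           = []
Arcs (x ∷ [])     = []
Arcs (x ∷ y ∷ xs) = (x , y) ∷ Arcs (y ∷ xs)

ArcsC : ∀ {A : Set} → List (List A) → List (A × A)
ArcsC C = concatMap Arcs C

IsPathCover : ∀ n → List (List (Fin n)) → Set
IsPathCover n C =
  All IsPath C ×
  (∀ (v : Fin n) → Σ (Fin (length C)) λ i →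
     (v ∈ lookup C i) × (∀ j → v ∈ lookup C j → j ≡ i))

-- F ⊆ A_σ, with A_σ = {(v, σ v)}.
SubsetArcsPerm : ∀ {n} → (Fin n × Fin n → Set) → Permutation′ n → Set
SubsetArcsPerm {n} F σ = ∀ (u v : Fin n) → F (u , v) → σ ⟨$⟩ʳ u ≡ v

-- There are exactly k permutations of Fin n satisfying P (permutations
-- compared extensionally): an injective enumeration Fin k → permutations
-- of exactly those satisfying P.
ExactlyPerms : ∀ n → (Permutation′ n → Set) → ℕ → Set
ExactlyPerms n P k =
  Σ (Fin k → Permutation′ n) λ e →
    (∀ i → P (e i)) ×
    (∀ i j → e i ≈ e j → i ≡ j) ×
    (∀ σ → P σ → Σ (Fin k) λ i → σ ≈ e i)

-- The arcs of a path cover have pairwise distinct sources and pairwise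
-- distinct targets, because every vertex lies on exactly one path; so they
-- form a partial injection, and σ ⊇ F just says that σ extends it.  A partial
-- injection with m arcs on n points has exactly (n ∸ m)! extensions: fixing
-- σ u = v for one arc (u , v) and deleting u from the domain and v from the
-- codomain leaves a partial injection with m - 1 arcs on n - 1 points.  A path
-- with k vertices has k - 1 arcs and the paths partition the n vertices, so
-- there are n ∸ |C| arcs and hence |C|! permutations.
module Submission where

open import Defs
open import Data.Nat using (ℕ; zero; suc; _∸_; _*_; _+_; _!)
open import Data.Nat.Properties using (+-suc; +-assoc; m+n∸m≡n; ≤-antisym)
open import Data.Fin using (Fin; zero; suc; punchIn; punchOut; combine; remQuot)
open import Data.Fin.Properties using (_≟_; punchIn-injective; punchOut-injective; punchIn-punchOut; combine-remQuot; remQuot-combine; injective⇒≤)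
open import Data.Fin.Permutation using (Permutation′; _⟨$⟩ʳ_; _≈_; id; insert; remove; insert-punchIn; insert-remove; remove-insert)
open import Data.List using (List; []; _∷_; length; lookup; map; concat; _++_)
open import Data.List.Properties using (length-++; map-++; tabulate-lookup)
open import Data.List.Relation.Unary.All using (All; []; _∷_)
import Data.List.Relation.Unary.All as All
open import Data.List.Relation.Unary.AllPairs using (AllPairs; []; _∷_)
import Data.List.Relation.Unary.AllPairs as AllPairs
import Data.List.Relation.Unary.AllPairs.Properties as AllPairs
open import Data.List.Relation.Unary.Unique.Propositional using (Unique)
import Data.List.Relation.Unary.Unique.Propositional.Properties as Unique
open import Data.List.Relation.Binary.Disjoint.Propositional using (Disjoint)
open import Data.List.Relation.Binary.Sublist.Propositional using (_⊆_; []; _∷_; _∷ʳ_)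
open import Data.List.Relation.Binary.Sublist.Propositional.Properties using (All-resp-⊆; ++⁺)
open import Data.List.Membership.Propositional using (_∈_)
open import Data.List.Membership.Propositional.Properties using (∈-lookup; ∈-concat⁺′)
import Data.List.Membership.Setoid.Properties as Membership
open import Data.Product using (Σ; _×_; _,_; proj₁; proj₂; uncurry)
open import Data.Unit using (⊤; tt)
open import Function.Base using (_∘_)
open import Function.Bundles using (_⇔_; mk⇔; Equivalence)
open import Function.Construct.Symmetry using (⇔-sym)
open import Relation.Binary.PropositionalEquality
open import Relation.Nullary using (yes; no; contradiction)

private
  variable
    n : ℕ

insert-at : ∀ i j (π : Permutation′ n) → insert i j π ⟨$⟩ʳ i ≡ j
insert-at i j π with i ≟ i
... | yes _   = refl
... | no i≢i = contradiction refl i≢i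

insert-cong : ∀ i j {π ρ : Permutation′ n} → π ≈ ρ → insert i j π ≈ insert i j ρ
insert-cong i j π≈ρ k with i ≟ k
... | yes _   = refl
... | no i≢k = cong (punchIn j) (π≈ρ (punchOut i≢k))

insert-injective : ∀ i j {π ρ : Permutation′ n} → insert i j π ≈ insert i j ρ → π ≈ ρ
insert-injective i j {π} {ρ} eq k = punchIn-injective j _ _ (begin
  punchIn j (π ⟨$⟩ʳ k)          ≡⟨ insert-punchIn i j π k ⟨
  insert i j π ⟨$⟩ʳ punchIn i k ≡⟨ eq (punchIn i k) ⟩
  insert i j ρ ⟨$⟩ʳ punchIn i k ≡⟨ insert-punchIn i j ρ k ⟩
  punchIn j (ρ ⟨$⟩ʳ k)          ∎)
  where open ≡-Reasoning

≈-insert-remove : ∀ {i j} (σ : Permutation′ (suc n)) → σ ⟨$⟩ʳ i ≡ j → σ ≈ insert i j (remove i σ)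
≈-insert-remove {i = i} σ refl k = sym (insert-remove i σ k)

remove-punchOut : ∀ (σ : Permutation′ (suc n)) {i a} (i≢a : i ≢ a) →
  σ ⟨$⟩ʳ a ≡ punchIn (σ ⟨$⟩ʳ i) (remove i σ ⟨$⟩ʳ punchOut i≢a)
remove-punchOut σ {i} {a} i≢a = begin
  σ ⟨$⟩ʳ a                                          ≡⟨ insert-remove i σ a ⟨
  σ′ ⟨$⟩ʳ a                                         ≡⟨ cong (σ′ ⟨$⟩ʳ_) (punchIn-punchOut i≢a) ⟨
  σ′ ⟨$⟩ʳ punchIn i (punchOut i≢a)                  ≡⟨ insert-punchIn i (σ ⟨$⟩ʳ i) (remove i σ) (punchOut i≢a) ⟩
  punchIn (σ ⟨$⟩ʳ i) (remove i σ ⟨$⟩ʳ punchOut i≢a) ∎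
  where
  open ≡-Reasoning
  σ′ = insert i (σ ⟨$⟩ʳ i) (remove i σ)

remove-maps⇔ : ∀ (σ : Permutation′ (suc n)) {i j a b} → σ ⟨$⟩ʳ i ≡ j → (i≢a : i ≢ a) (j≢b : j ≢ b) →
  (σ ⟨$⟩ʳ a ≡ b) ⇔ (remove i σ ⟨$⟩ʳ punchOut i≢a ≡ punchOut j≢b)
remove-maps⇔ σ refl i≢a j≢b = mk⇔
  (λ σa≡b → punchIn-injective _ _ _
    (trans (sym (remove-punchOut σ i≢a)) (trans σa≡b (sym (punchIn-punchOut j≢b)))))
  (λ eq → trans (remove-punchOut σ i≢a) (trans (cong (punchIn _) eq) (punchIn-punchOut j≢b)))

exactlyPerms-resp : ∀ {k} {P Q : Permutation′ n → Set} → (∀ σ → P σ ⇔ Q σ) →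
  ExactlyPerms n P k → ExactlyPerms n Q k
exactlyPerms-resp P⇔Q (e , good , inj , surj) =
  e , (λ r → Equivalence.to (P⇔Q (e r)) (good r)) , inj ,
  λ σ Qσ → surj σ (Equivalence.from (P⇔Q σ) Qσ)

exactlyPerms-insert : ∀ {k} {P : Permutation′ n → Set} i j → (∀ σ τ → σ ≈ τ → P σ → P τ) →
  ExactlyPerms n P k → ExactlyPerms (suc n) (λ σ → σ ⟨$⟩ʳ i ≡ j × P (remove i σ)) k
exactlyPerms-insert i j P-resp (e , good , inj , surj) =
  (λ r → insert i j (e r)) ,
  (λ r → insert-at i j (e r) , P-resp (e r) _ (λ k → sym (remove-insert i j (e r) k)) (good r)) ,
  (λ r s eq → inj r s (insert-injective i j eq)) ,
  λ { σ (σi≡j , Pσ) → let (r , σ′≈er) = surj (remove i σ) Pσ in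
      r , λ k → trans (≈-insert-remove σ σi≡j k) (insert-cong i j σ′≈er k) }

-- The class f σ ≡ v is enumerated by the v-th block of Fin (m * k) ≅ Fin m × Fin k.
exactlyPerms-partition : ∀ {m k} {P : Permutation′ n → Set} (f : Permutation′ n → Fin m) →
  (∀ σ τ → σ ≈ τ → f σ ≡ f τ) →
  (∀ v → ExactlyPerms n (λ σ → f σ ≡ v × P σ) k) →
  ExactlyPerms n P (m * k)
exactlyPerms-partition {n = n} {m = m} {k} {P} f f-cong classes =
  (λ x → enum (remQuot k x)) ,
  (λ x → proj₂ (good (remQuot k x))) ,
  (λ x y eq → begin
     x                                 ≡⟨ combine-remQuot {m} k x ⟨
     uncurry combine (remQuot {m} k x) ≡⟨ cong (uncurry combine) (enum-injective _ _ eq) ⟩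
     uncurry combine (remQuot {m} k y) ≡⟨ combine-remQuot {m} k y ⟩
     y                                 ∎) ,
  λ σ Pσ → let (r , σ≈e) = surj (f σ) σ (refl , Pσ) in
    combine (f σ) r , subst (λ vr → σ ≈ enum vr) (sym (remQuot-combine (f σ) r)) σ≈e
  where
  open ≡-Reasoning
  enum : Fin m × Fin k → Permutation′ n
  enum (v , r) = proj₁ (classes v) r
  good : ∀ vr → f (enum vr) ≡ proj₁ vr × P (enum vr)
  good (v , r) = proj₁ (proj₂ (classes v)) r
  surj : ∀ v σ → f σ ≡ v × P σ → Σ (Fin k) λ r → σ ≈ enum (v , r)
  surj v = proj₂ (proj₂ (proj₂ (classes v)))
  enum-injective : ∀ vr ws → enum vr ≈ enum ws → vr ≡ ws
  enum-injective (v , r) (w , s) eq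
    with refl ← trans (sym (proj₁ (good (v , r)))) (trans (f-cong _ _ eq) (proj₁ (good (w , s))))
    = cong (v ,_) (proj₁ (proj₂ (proj₂ (classes v))) r s eq)

permutations-count : ∀ n → ExactlyPerms n (λ _ → ⊤) (n !)
permutations-count zero =
  (λ _ → id) , (λ _ → tt) , (λ { zero zero _ → refl }) , λ _ _ → zero , λ ()
permutations-count (suc n) =
  exactlyPerms-partition (_⟨$⟩ʳ zero) (λ _ _ σ≈τ → σ≈τ zero)
    (λ v → exactlyPerms-insert zero v (λ _ _ _ _ → tt) (permutations-count n))

Arc : ℕ → Set
Arc n = Fin n × Fin n

Extends : Permutation′ n → List (Arc n) → Set
Extends σ A = All (λ ab → σ ⟨$⟩ʳ proj₁ ab ≡ proj₂ ab) A

extends-resp-≈ : ∀ A (σ τ : Permutation′ n) → σ ≈ τ → Extends σ A → Extends τ A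
extends-resp-≈ A σ τ σ≈τ = All.map λ {ab} σa≡b → trans (sym (σ≈τ (proj₁ ab))) σa≡b

Apart : Arc n → Arc n → Set
Apart (a , b) (c , d) = a ≢ c × b ≢ d

-- Sources are relabelled along Fin (suc n) ∖ {u} ≅ Fin n and targets along
-- Fin (suc n) ∖ {v} ≅ Fin n, exactly as remove u does to a σ with σ u ≡ v.
contract : ∀ {u v : Fin (suc n)} {A} → All (Apart (u , v)) A → List (Arc n)
contract = All.reduce λ (u≢a , v≢b) → punchOut u≢a , punchOut v≢b

length-contract : ∀ {u v : Fin (suc n)} {A} (apart : All (Apart (u , v)) A) →
  length (contract apart) ≡ length A
length-contract []          = refl
length-contract (_ ∷ apart) = cong suc (length-contract apart)

contract-apart : ∀ {u v a b : Fin (suc n)} {A} (u≢a : u ≢ a) (v≢b : v ≢ b) (apart : All (Apart (u , v)) A) →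
  All (Apart (a , b)) A → All (Apart (punchOut u≢a , punchOut v≢b)) (contract apart)
contract-apart u≢a v≢b [] [] = []
contract-apart u≢a v≢b ((u≢c , v≢d) ∷ apart) ((a≢c , b≢d) ∷ apart′) =
  (a≢c ∘ punchOut-injective u≢a u≢c , b≢d ∘ punchOut-injective v≢b v≢d) ∷ contract-apart u≢a v≢b apart apart′

contract-allPairs : ∀ {u v : Fin (suc n)} {A} (apart : All (Apart (u , v)) A) →
  AllPairs Apart A → AllPairs Apart (contract apart)
contract-allPairs [] [] = []
contract-allPairs ((u≢a , v≢b) ∷ apart) (apart′ ∷ pairs) =
  contract-apart u≢a v≢b apart apart′ ∷ contract-allPairs apart pairs

extends-contract⇔ : ∀ (σ : Permutation′ (suc n)) {u v A} → σ ⟨$⟩ʳ u ≡ v → (apart : All (Apart (u , v)) A) →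
  Extends σ A ⇔ Extends (remove u σ) (contract apart)
extends-contract⇔ σ σu≡v [] = mk⇔ (λ _ → []) (λ _ → [])
extends-contract⇔ σ σu≡v ((u≢a , v≢b) ∷ apart) = mk⇔
  (λ { (σa≡b ∷ ext) → Equivalence.to head σa≡b ∷ Equivalence.to tail ext })
  (λ { (σa≡b ∷ ext) → Equivalence.from head σa≡b ∷ Equivalence.from tail ext })
  where
  head = remove-maps⇔ σ σu≡v u≢a v≢b
  tail = extends-contract⇔ σ σu≡v apart

extends-∷⇔ : ∀ (σ : Permutation′ (suc n)) {u v A} (apart : All (Apart (u , v)) A) →
  Extends σ ((u , v) ∷ A) ⇔ (σ ⟨$⟩ʳ u ≡ v × Extends (remove u σ) (contract apart))
extends-∷⇔ σ apart = mk⇔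
  (λ { (σu≡v ∷ ext) → σu≡v , Equivalence.to (extends-contract⇔ σ σu≡v apart) ext })
  (λ (σu≡v , ext) → σu≡v ∷ Equivalence.from (extends-contract⇔ σ σu≡v apart) ext)

extensions-count : ∀ n (A : List (Arc n)) → AllPairs Apart A →
  ExactlyPerms n (λ σ → Extends σ A) ((n ∸ length A) !)
extensions-count n [] [] =
  exactlyPerms-resp (λ _ → mk⇔ (λ _ → []) (λ _ → tt)) (permutations-count n)
extensions-count zero ((() , _) ∷ _) _
extensions-count (suc n) ((u , v) ∷ A) (apart ∷ pairs) =
  exactlyPerms-resp (λ σ → ⇔-sym (extends-∷⇔ σ apart))
    (exactlyPerms-insert u v (λ σ τ → extends-resp-≈ (contract apart) σ τ) contracted-count)
  where
  contracted-count : ExactlyPerms n (λ τ → Extends τ (contract apart)) ((n ∸ length A) !)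
  contracted-count = subst (λ ℓ → ExactlyPerms n (λ τ → Extends τ (contract apart)) ((n ∸ ℓ) !))
    (length-contract apart) (extensions-count n (contract apart) (contract-allPairs apart pairs))

length-Arcs : ∀ {A : Set} (x : A) xs → length (Arcs (x ∷ xs)) ≡ length xs
length-Arcs x []       = refl
length-Arcs x (y ∷ ys) = cong suc (length-Arcs y ys)

length-ArcsC : ∀ {A : Set} (C : List (List A)) → All (_≢ []) C →
  length (ArcsC C) + length C ≡ length (concat C)
length-ArcsC [] [] = refl
length-ArcsC ([] ∷ C) (nonempty ∷ _) = contradiction refl nonempty
length-ArcsC ((x ∷ xs) ∷ C) (_ ∷ nonempty) = begin
  length (Arcs (x ∷ xs) ++ ArcsC C) + suc (length C)
    ≡⟨ cong (_+ suc (length C)) (length-++ (Arcs (x ∷ xs))) ⟩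
  length (Arcs (x ∷ xs)) + length (ArcsC C) + suc (length C)
    ≡⟨ cong (λ ℓ → ℓ + length (ArcsC C) + suc (length C)) (length-Arcs x xs) ⟩
  length xs + length (ArcsC C) + suc (length C)
    ≡⟨ trans (+-suc _ (length C)) (cong suc (+-assoc (length xs) _ _)) ⟩
  suc (length xs + (length (ArcsC C) + length C))
    ≡⟨ cong (λ ℓ → suc (length xs + ℓ)) (length-ArcsC C nonempty) ⟩
  suc (length xs + length (concat C))
    ≡⟨ length-++ (x ∷ xs) ⟨
  length ((x ∷ xs) ++ concat C)
    ∎
  where open ≡-Reasoning

sources-⊆ : ∀ {A : Set} (p : List A) → map proj₁ (Arcs p) ⊆ p
sources-⊆ []           = []
sources-⊆ (x ∷ [])     = x ∷ʳ []
sources-⊆ (x ∷ y ∷ ys) = refl ∷ sources-⊆ (y ∷ ys)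

targets-⊆ : ∀ {A : Set} (p : List A) → map proj₂ (Arcs p) ⊆ p
targets-⊆ []       = []
targets-⊆ (x ∷ xs) = x ∷ʳ targets-⊆-tail x xs
  where
  targets-⊆-tail : ∀ x xs → map proj₂ (Arcs (x ∷ xs)) ⊆ xs
  targets-⊆-tail x []       = []
  targets-⊆-tail x (y ∷ ys) = refl ∷ targets-⊆-tail y ys

map-ArcsC-⊆ : ∀ {A : Set} (f : A × A → A) → (∀ p → map f (Arcs p) ⊆ p) →
  ∀ C → map f (ArcsC C) ⊆ concat C
map-ArcsC-⊆ f f⊆ []      = []
map-ArcsC-⊆ f f⊆ (p ∷ C) = subst (_⊆ p ++ concat C) (sym (map-++ f (Arcs p) (ArcsC C)))
  (++⁺ (f⊆ p) (map-ArcsC-⊆ f f⊆ C))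

allPairs-resp-⊇ : ∀ {A : Set} {R : A → A → Set} {xs ys} → xs ⊆ ys → AllPairs R ys → AllPairs R xs
allPairs-resp-⊇ []              []             = []
allPairs-resp-⊇ (_ ∷ʳ xs⊆ys)    (_ ∷ pairs)    = allPairs-resp-⊇ xs⊆ys pairs
allPairs-resp-⊇ (refl ∷ xs⊆ys)  (x~ys ∷ pairs) = All-resp-⊆ xs⊆ys x~ys ∷ allPairs-resp-⊇ xs⊆ys pairs

apart-ArcsC : ∀ (C : List (List (Fin n))) → Unique (concat C) → AllPairs Apart (ArcsC C)
apart-ArcsC C unique = AllPairs.zip
  ( AllPairs.map⁻ (allPairs-resp-⊇ (map-ArcsC-⊆ proj₁ sources-⊆ C) unique)
  , AllPairs.map⁻ (allPairs-resp-⊇ (map-ArcsC-⊆ proj₂ targets-⊆ C) unique))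

lookup-injective : ∀ {A : Set} {xs : List A} → Unique xs → ∀ {i j} → lookup xs i ≡ lookup xs j → i ≡ j
lookup-injective (_ ∷ unique) {zero}  {zero}  _  = refl
lookup-injective (x∉ ∷ unique) {zero}  {suc j} eq = contradiction eq (All.lookup x∉ (∈-lookup j))
lookup-injective (x∉ ∷ unique) {suc i} {zero}  eq = contradiction (sym eq) (All.lookup x∉ (∈-lookup i))
lookup-injective (_ ∷ unique) {suc i} {suc j} eq = cong suc (lookup-injective unique eq)

length-unique-complete : ∀ {xs : List (Fin n)} → Unique xs → (∀ v → v ∈ xs) → length xs ≡ n
length-unique-complete unique complete = ≤-antisym
  (injective⇒≤ (lookup-injective unique))
  (injective⇒≤ (Membership.index-injective (setoid _) (complete _) (complete _)))

module _ {C : List (List (Fin n))} (cover : IsPathCover n C) where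

  pathCover-unique : Unique (concat C)
  pathCover-unique = Unique.concat⁺ (All.map proj₂ (proj₁ cover))
    (subst (AllPairs Disjoint) (tabulate-lookup C) (AllPairs.tabulate⁺ disjoint))
    where
    disjoint : ∀ {i j} → i ≢ j → Disjoint (lookup C i) (lookup C j)
    disjoint {i} {j} i≢j {v} (v∈i , v∈j) =
      let (_ , _ , unique) = proj₂ cover v in i≢j (trans (unique i v∈i) (sym (unique j v∈j)))

  pathCover-complete : ∀ v → v ∈ concat C
  pathCover-complete v = let (i , v∈i , _) = proj₂ cover v in ∈-concat⁺′ v∈i (∈-lookup {xs = C} i)

  length-ArcsC-pathCover : length (ArcsC C) + length C ≡ n
  length-ArcsC-pathCover = trans (length-ArcsC C (All.map proj₁ (proj₁ cover)))
    (length-unique-complete pathCover-unique pathCover-complete)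

proposition2p13 : (n : ℕ) (F : Fin n × Fin n → Set) (C : List (List (Fin n))) →
    IsPathCover n C →
    (∀ a → F a ⇔ (a ∈ ArcsC C)) →
    ExactlyPerms n (SubsetArcsPerm F) ((length C) !)
proposition2p13 n F C cover F⇔arc =
  subst (λ ℓ → ExactlyPerms n (SubsetArcsPerm F) (ℓ !)) n∸arcs≡paths
    (exactlyPerms-resp extends⇔subsetArcs
      (extensions-count n (ArcsC C) (apart-ArcsC C (pathCover-unique cover))))
  where
  n∸arcs≡paths : n ∸ length (ArcsC C) ≡ length C
  n∸arcs≡paths = trans (cong (_∸ length (ArcsC C)) (sym (length-ArcsC-pathCover cover)))
    (m+n∸m≡n (length (ArcsC C)) (length C))
  extends⇔subsetArcs : ∀ σ → Extends σ (ArcsC C) ⇔ SubsetArcsPerm F σ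
  extends⇔subsetArcs σ = mk⇔
    (λ ext u v Fuv → All.lookup ext (Equivalence.to (F⇔arc (u , v)) Fuv))
    (λ σ⊇F → All.tabulate λ {uv} uv∈ → σ⊇F (proj₁ uv) (proj₂ uv) (Equivalence.from (F⇔arc uv) uv∈))
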